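{- Let $\mathcal{N}$ be a tree-child network with no $3$-cycles, and let $e=(u,v)$ be a reticulation arc of $\mathcal{N}$ such that, amongst all reticulation arcs of $\mathcal{N}$, $u$ has minimum distance to the root of $\mathcal{N}$ (i.e. no tail of a reticulation arc is strictly closer to the root than $u$). Then $\mathcal{N}\backslash e$ is tree-child and has no $3$-cycles.
   Context: A (rooted binary) phylogenetic network on a non-empty finite set $X$ is a rooted acyclic directed graph with no parallel arcs such that the root has in-degree $0$ and out-degree $2$, the vertices of out-degree $0$ (leaves) are exactly $X$, and every other vertex has in-degree $1$ and out-degree $2$ (tree vertex) or in-degree $2$ and out-degree $1$ (reticulation); if $|X|=1$ the network may be a single vertex. Arcs into reticulations are reticulation arcs. A network is tree-child if every non-leaf vertex has a child that is a tree vertex or a leaf. A $3$-cycle is a cycle of length $3$ in the underlying undirected graph. For a tree-child network $\mathcal{N}$ with root $\rho$ and a reticulation arc $e=(u,v)$, $\mathcal{N}\backslash e$ denotes the network obtained by deleting $e$ and then, if $u\ne\rho$, suppressing the two resulting vertices of in-degree one and out-degree one, or, if $u=\rho$, suppressing the resulting vertex of in-degree one and out-degree one and deleting $u$. -}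

module Defs where

open import Data.Nat using (ℕ; zero; suc; _≤_; _≟_)
open import Data.Nat.Properties using ()
open import Data.Product using (Σ; Σ-syntax; ∃; ∃-syntax; _×_; _,_; proj₁; proj₂)
open import Data.Product.Properties using (≡-dec)
open import Data.Sum using (_⊎_)
open import Data.List using (List; []; _∷_; length; filter; map; cartesianProduct; _++_)
open import Data.List.Membership.Propositional using (_∈_)
open import Data.List.Relation.Unary.Unique.Propositional using (Unique)
open import Relation.Binary.PropositionalEquality using (_≡_; _≢_)
open import Relation.Nullary using (¬_; Dec; yes; no; ¬?)
open import Function.Bundles using (_⇔_)

-- A finite directed (multi)graph whose vertices are natural numbers.
-- Vertices: the list 'verts'; arcs: the list 'arcs' (a repeated entry = parallel arcs).
record Graph : Set where
  constructor graph
  field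
    verts : List ℕ
    arcs  : List (ℕ × ℕ)
open Graph public

Arc : Set
Arc = ℕ × ℕ

_≟A_ : (a b : Arc) → Dec (a ≡ b)
_≟A_ = ≡-dec _≟_ _≟_

inArcs : Graph → ℕ → List Arc
inArcs G w = filter (λ a → proj₂ a ≟ w) (arcs G)

outArcs : Graph → ℕ → List Arc
outArcs G w = filter (λ a → proj₁ a ≟ w) (arcs G)

indeg : Graph → ℕ → ℕ
indeg G w = length (inArcs G w)

outdeg : Graph → ℕ → ℕ
outdeg G w = length (outArcs G w)

parents : Graph → ℕ → List ℕ
parents G w = map proj₁ (inArcs G w)

children : Graph → ℕ → List ℕ
children G w = map proj₂ (outArcs G w)

data PathLen (G : Graph) : ℕ → ℕ → ℕ → Set where
  here : ∀ {x} → PathLen G x x zero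
  step : ∀ {x y z k} → (x , y) ∈ arcs G → PathLen G y z k → PathLen G x z (suc k)

Acyclic : Graph → Set
Acyclic G = ∀ x k → ¬ PathLen G x x (suc k)

IsDist : Graph → ℕ → ℕ → ℕ → Set
IsDist G x y d = PathLen G x y d × (∀ k → PathLen G x y k → d ≤ k)

IsLeaf : Graph → ℕ → Set
IsLeaf G w = w ∈ verts G × outdeg G w ≡ 0

IsTreeVertex : Graph → ℕ → Set
IsTreeVertex G w = w ∈ verts G × indeg G w ≡ 1 × outdeg G w ≡ 2

IsReticulation : Graph → ℕ → Set
IsReticulation G w = w ∈ verts G × indeg G w ≡ 2 × outdeg G w ≡ 1

IsReticulationArc : Graph → Arc → Set
IsReticulationArc G (u , v) = (u , v) ∈ arcs G × IsReticulation G v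

record IsProperNetwork (X : List ℕ) (G : Graph) (ρ : ℕ) : Set where
  field
    vertsUnique  : Unique (verts G)
    noParallel   : Unique (arcs G)
    arcsTail     : ∀ {a b} → (a , b) ∈ arcs G → a ∈ verts G
    arcsHead     : ∀ {a b} → (a , b) ∈ arcs G → b ∈ verts G
    acyclic      : Acyclic G
    rootVert     : ρ ∈ verts G
    rootIndeg    : indeg G ρ ≡ 0
    rootOutdeg   : outdeg G ρ ≡ 2
    otherVerts   : ∀ w → w ∈ verts G → w ≢ ρ →
                     (indeg G w ≡ 1 × outdeg G w ≡ 0)
                   ⊎ (indeg G w ≡ 1 × outdeg G w ≡ 2)
                   ⊎ (indeg G w ≡ 2 × outdeg G w ≡ 1)
    leavesAreX   : ∀ w → IsLeaf G w ⇔ w ∈ X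
    XNonEmpty    : Σ ℕ (λ x → x ∈ X)

IsNetwork : List ℕ → Graph → ℕ → Set
IsNetwork X G ρ =
    (X ≡ ρ ∷ [] × verts G ≡ ρ ∷ [] × arcs G ≡ [])
  ⊎ IsProperNetwork X G ρ

IsTreeChild : Graph → Set
IsTreeChild G = ∀ w → w ∈ verts G → ¬ (outdeg G w ≡ 0) →
  Σ ℕ (λ c → (w , c) ∈ arcs G × (IsTreeVertex G c ⊎ IsLeaf G c))

IsTreeChildNetwork : List ℕ → Graph → ℕ → Set
IsTreeChildNetwork X G ρ = IsNetwork X G ρ × IsTreeChild G

Adj : Graph → ℕ → ℕ → Set
Adj G x y = (x , y) ∈ arcs G ⊎ (y , x) ∈ arcs G

HasThreeCycle : Graph → Set
HasThreeCycle G = Σ ℕ λ a → Σ ℕ λ b → Σ ℕ λ c →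
  a ≢ b × b ≢ c × a ≢ c × Adj G a b × Adj G b c × Adj G c a

deleteArc : Arc → Graph → Graph
deleteArc e G = graph (verts G) (filter (λ a → ¬? (a ≟A e)) (arcs G))

deleteVertex : ℕ → Graph → Graph
deleteVertex w G =
  graph (filter (λ x → ¬? (x ≟ w)) (verts G))
        (filter (λ a → ¬? (proj₂ a ≟ w)) (filter (λ a → ¬? (proj₁ a ≟ w)) (arcs G)))

-- When w has in-degree 1 and out-degree 1 (the only case
-- in which it is used) this replaces (p,w),(w,c) by the single arc (p,c).
suppress : ℕ → Graph → Graph
suppress w G =
  graph (verts (deleteVertex w G))
        (cartesianProduct (parents G w) (children G w) ++ arcs (deleteVertex w G))

delRetArc : Graph → ℕ → Arc → Graph
delRetArc G ρ (u , v) with u ≟ ρ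
... | yes _ = deleteVertex u (suppress v (deleteArc (u , v) G))
... | no  _ = suppress v (suppress u (deleteArc (u , v) G))

{-# OPTIONS --safe #-}
-- Write e = (u , v), let q be the other parent of v, w the child of v and c the other
-- child of u; by tree-child, w and c are tree vertices or leaves.  N \ e keeps the arcs
-- avoiding u and v and adds (q , w) and, when u has a parent p, (p , c); when u is the
-- root, c becomes the new root, and it is a tree vertex because q must be reachable from
-- u without passing through v.  Degrees away from u, v and the new root are unchanged,
-- so N \ e is again a tree-child network.  The added arcs share no endpoint, so a
-- 3-cycle of N \ e consists of one added arc and two arcs of N: around (q , w) it makes
-- q the tail of two reticulation arcs, against tree-child; around (p , c) it makes p the
-- tail of a reticulation arc, although p is strictly closer to the root than u.
module Submission where

open import Defs
open import Data.Nat using (ℕ; zero; suc; _+_; _≤_; _<_; z≤n; s≤s; _≟_)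
open import Data.Nat.Properties using (anyUpTo?; ≮⇒≥; ≤⇒≯; ≤-trans; <-irrefl; 1+n≢0)
open import Data.Nat.Induction using (<-rec)
open import Data.Product using (∃; Σ; _×_; _,_; proj₁; proj₂)
open import Data.Sum using (_⊎_; inj₁; inj₂)
import Data.Sum as Sum
open import Data.Empty using (⊥; ⊥-elim)
open import Data.List using (List; []; _∷_; length; filter)
import Data.List as List
open import Data.List.Relation.Unary.Any using (here; there; any?)
import Data.List.Relation.Unary.Any as Any
open import Data.List.Relation.Unary.All using (All; []; _∷_)
open import Data.List.Relation.Unary.All.Properties using (¬Any⇒All¬)
open import Data.List.Relation.Unary.AllPairs using ([]; _∷_)
open import Data.List.Membership.Propositional using (_∈_; _∉_; find; lose)
open import Data.List.Membership.Propositional.Properties using (∈-filter⁺; ∈-filter⁻)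
open import Data.List.Properties using (filter-notAll)
open import Data.List.Membership.Propositional.Properties.WithK using (unique∧set⇒bag)
open import Data.List.Relation.Unary.Unique.Propositional using (Unique)
import Data.List.Relation.Unary.Unique.Propositional.Properties as Unique
open import Data.List.Relation.Binary.BagAndSetEquality using (∼bag⇒↭)
open import Data.List.Relation.Binary.Permutation.Propositional.Properties using (↭-length)
open import Relation.Binary.PropositionalEquality using (_≡_; _≢_; refl; sym; trans; cong; subst; module ≡-Reasoning)
open import Relation.Binary.Definitions using (DecidableEquality)
open import Relation.Nullary using (¬_; Dec; yes; no; ¬?; contradiction)
open import Relation.Nullary.Decidable using (_×-dec_)
open import Function.Base using (_∘_)
open import Function.Bundles using (_⇔_; mk⇔; Equivalence)
import Function.Properties.Equivalence as ⇔

private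
  variable
    A : Set
    xs ys : List A
    x y : A

length-≡-of-same-members : Unique xs → Unique ys → (∀ {z} → z ∈ xs ⇔ z ∈ ys) →
  length xs ≡ length ys
length-≡-of-same-members xs! ys! xs⇔ys = ↭-length (∼bag⇒↭ (unique∧set⇒bag xs! ys! xs⇔ys))

length-≡-of-replacement : DecidableEquality A → {a b : A} → Unique xs → Unique ys →
  a ∈ xs → b ∉ xs → (∀ {z} → z ∈ ys ⇔ (z ≡ b ⊎ (z ∈ xs × z ≢ a))) →
  length ys ≡ length xs
length-≡-of-replacement {xs = xs} {ys = ys} _≟ᴬ_ {a} {b} xs! ys! a∈xs b∉xs ys⇔ = begin
  length ys         ≡⟨ length-≡-of-same-members ys! (b∉rest ∷ rest!) (mk⇔ to-b∷rest from-b∷rest) ⟩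
  length (b ∷ rest) ≡⟨⟩
  length (a ∷ rest) ≡⟨ length-≡-of-same-members (a∉rest ∷ rest!) xs! (mk⇔ from-a∷rest to-a∷rest) ⟩
  length xs         ∎
  where
  open ≡-Reasoning
  rest : List _
  rest = filter (λ z → ¬? (z ≟ᴬ a)) xs
  rest! : Unique rest
  rest! = Unique.filter⁺ (λ z → ¬? (z ≟ᴬ a)) xs!
  ∈rest⁻ : ∀ {z} → z ∈ rest → z ∈ xs × ¬ z ≡ a
  ∈rest⁻ = ∈-filter⁻ (λ z → ¬? (z ≟ᴬ a))
  ∈rest⁺ : ∀ {z} → z ∈ xs → z ≢ a → z ∈ rest
  ∈rest⁺ = ∈-filter⁺ (λ z → ¬? (z ≟ᴬ a))
  b∉rest : All (b ≢_) rest
  b∉rest = ¬Any⇒All¬ rest (b∉xs ∘ proj₁ ∘ ∈rest⁻)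
  a∉rest : All (a ≢_) rest
  a∉rest = ¬Any⇒All¬ rest (λ a∈rest → proj₂ (∈rest⁻ a∈rest) refl)
  to-b∷rest : ∀ {z} → z ∈ ys → z ∈ b ∷ rest
  to-b∷rest z∈ys with Equivalence.to ys⇔ z∈ys
  ... | inj₁ refl = here refl
  ... | inj₂ (z∈xs , z≢a) = there (∈rest⁺ z∈xs z≢a)
  from-b∷rest : ∀ {z} → z ∈ b ∷ rest → z ∈ ys
  from-b∷rest (here refl) = Equivalence.from ys⇔ (inj₁ refl)
  from-b∷rest (there z∈rest) = Equivalence.from ys⇔ (inj₂ (∈rest⁻ z∈rest))
  to-a∷rest : ∀ {z} → z ∈ xs → z ∈ a ∷ rest
  to-a∷rest {z} z∈xs with z ≟ᴬ a
  ... | yes refl = here refl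
  ... | no z≢a = there (∈rest⁺ z∈xs z≢a)
  from-a∷rest : ∀ {z} → z ∈ a ∷ rest → z ∈ xs
  from-a∷rest (here refl) = a∈xs
  from-a∷rest (there z∈rest) = proj₁ (∈rest⁻ z∈rest)

length≡0⇒∉ : length xs ≡ 0 → x ∉ xs
length≡0⇒∉ {xs = []} _ ()

∉⇒length≡0 : (∀ {z} → z ∉ xs) → length xs ≡ 0
∉⇒length≡0 {xs = []} _ = refl
∉⇒length≡0 {xs = _ ∷ _} ∉xs = ⊥-elim (∉xs (here refl))

length≢0⇒∈ : length xs ≢ 0 → ∃ (_∈ xs)
length≢0⇒∈ {xs = []} ≢0 = ⊥-elim (≢0 refl)
length≢0⇒∈ {xs = z ∷ _} _ = z , here refl

length≡1⇒≡ : length xs ≡ 1 → x ∈ xs → y ∈ xs → x ≡ y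
length≡1⇒≡ {xs = _ ∷ []} _ (here refl) (here refl) = refl

length≡1⇒singleton : length xs ≡ 1 → x ∈ xs → xs ≡ x ∷ []
length≡1⇒singleton {xs = _ ∷ []} _ (here refl) = refl

length≡2⇒other : Unique xs → length xs ≡ 2 → x ∈ xs →
  ∃ λ x′ → x′ ≢ x × x′ ∈ xs × ∀ {z} → z ∈ xs → z ≡ x ⊎ z ≡ x′
length≡2⇒other {xs = x₁ ∷ x₂ ∷ []} ((x₁≢x₂ ∷ []) ∷ _) _ (here refl) =
  x₂ , (λ e → x₁≢x₂ (sym e)) , there (here refl) ,
  λ { (here e) → inj₁ e ; (there (here e)) → inj₂ e }
length≡2⇒other {xs = x₁ ∷ x₂ ∷ []} ((x₁≢x₂ ∷ []) ∷ _) _ (there (here refl)) =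
  x₁ , x₁≢x₂ , here refl ,
  λ { (here e) → inj₂ e ; (there (here e)) → inj₁ e }

∈-deleteArc⁻ : ∀ H {e z} → z ∈ arcs (deleteArc e H) → z ∈ arcs H × z ≢ e
∈-deleteArc⁻ H {e} = ∈-filter⁻ (λ a → ¬? (a ≟A e))

∈-deleteArc⁺ : ∀ H {e z} → z ∈ arcs H → z ≢ e → z ∈ arcs (deleteArc e H)
∈-deleteArc⁺ H {e} = ∈-filter⁺ (λ a → ¬? (a ≟A e))

deleteArc-unique : ∀ H {e} → Unique (arcs H) → Unique (arcs (deleteArc e H))
deleteArc-unique H {e} = Unique.filter⁺ (λ a → ¬? (a ≟A e))

∈-deleteVertex⁻ : ∀ H {r a b} → (a , b) ∈ arcs (deleteVertex r H) →
  (a , b) ∈ arcs H × a ≢ r × b ≢ r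
∈-deleteVertex⁻ H {r} m with ∈-filter⁻ (λ e → ¬? (proj₂ e ≟ r)) m
... | m′ , b≢r with ∈-filter⁻ (λ e → ¬? (proj₁ e ≟ r)) {xs = arcs H} m′
... | ab , a≢r = ab , a≢r , b≢r

∈-deleteVertex⁺ : ∀ H {r a b} → (a , b) ∈ arcs H → a ≢ r → b ≢ r →
  (a , b) ∈ arcs (deleteVertex r H)
∈-deleteVertex⁺ H {r} ab a≢r b≢r =
  ∈-filter⁺ (λ e → ¬? (proj₂ e ≟ r)) (∈-filter⁺ (λ e → ¬? (proj₁ e ≟ r)) ab a≢r) b≢r

deleteVertex-unique : ∀ H {r} → Unique (arcs H) → Unique (arcs (deleteVertex r H))
deleteVertex-unique H {r} H! =
  Unique.filter⁺ (λ e → ¬? (proj₂ e ≟ r)) (Unique.filter⁺ (λ e → ¬? (proj₁ e ≟ r)) H!)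

∈-verts-deleteVertex⁻ : ∀ H {r y} → y ∈ verts (deleteVertex r H) → y ∈ verts H × y ≢ r
∈-verts-deleteVertex⁻ H {r} = ∈-filter⁻ (λ z → ¬? (z ≟ r))

∈-verts-deleteVertex⁺ : ∀ H {r y} → y ∈ verts H → y ≢ r → y ∈ verts (deleteVertex r H)
∈-verts-deleteVertex⁺ H {r} = ∈-filter⁺ (λ z → ¬? (z ≟ r))

deleteVertex-uniqueVerts : ∀ H {r} → Unique (verts H) → Unique (verts (deleteVertex r H))
deleteVertex-uniqueVerts H {r} = Unique.filter⁺ (λ z → ¬? (z ≟ r))

-- In-arcs and out-arcs are handled uniformly: arcAt y z is the arc joining y to its
-- neighbour z, end selects y and nbr selects z.  For In, deg is indeg and neighbours
-- is parents; for Out, outdeg and children.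
module Incidence (end nbr : Arc → ℕ) (arcAt : ℕ → ℕ → Arc)
  (end-arcAt : ∀ y z → end (arcAt y z) ≡ y) (nbr-arcAt : ∀ y z → nbr (arcAt y z) ≡ z)
  (arcAt-η : ∀ e → arcAt (end e) (nbr e) ≡ e) where

  incident : Graph → ℕ → List Arc
  incident H y = filter (λ e → end e ≟ y) (arcs H)

  deg : Graph → ℕ → ℕ
  deg H y = length (incident H y)

  arcAt-injective : ∀ {y a b} → arcAt y a ≡ arcAt y b → a ≡ b
  arcAt-injective {y} {a} {b} e = trans (sym (nbr-arcAt y a)) (trans (cong nbr e) (nbr-arcAt y b))

  incident⁺ : ∀ H {y z} → arcAt y z ∈ arcs H → arcAt y z ∈ incident H y
  incident⁺ H {y} {z} m = ∈-filter⁺ (λ e → end e ≟ y) m (end-arcAt y z)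

  incident⊆arcs : ∀ H {y e} → e ∈ incident H y → e ∈ arcs H
  incident⊆arcs H {y} m = proj₁ (∈-filter⁻ (λ e → end e ≟ y) m)

  incident⁻ : ∀ H {y e} → e ∈ incident H y → ∃ λ z → e ≡ arcAt y z × arcAt y z ∈ arcs H
  incident⁻ H {y} {e} m with ∈-filter⁻ (λ e → end e ≟ y) m
  ... | e∈H , refl = nbr e , sym (arcAt-η e) , subst (_∈ arcs H) (sym (arcAt-η e)) e∈H

  incident-unique : ∀ H {y} → Unique (arcs H) → Unique (incident H y)
  incident-unique H {y} = Unique.filter⁺ (λ e → end e ≟ y)

  deg≡0⇒∉ : ∀ H {y z} → deg H y ≡ 0 → arcAt y z ∉ arcs H
  deg≡0⇒∉ H deg≡0 m = length≡0⇒∉ deg≡0 (incident⁺ H m)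

  ∉⇒deg≡0 : ∀ H {y} → (∀ {z} → arcAt y z ∉ arcs H) → deg H y ≡ 0
  ∉⇒deg≡0 H ∉H = ∉⇒length≡0 λ m → ∉H (proj₂ (proj₂ (incident⁻ H m)))

  deg≢0⇒∈ : ∀ H {y} → deg H y ≢ 0 → ∃ λ z → arcAt y z ∈ arcs H
  deg≢0⇒∈ H deg≢0 = let _ , m = length≢0⇒∈ deg≢0 ; z , _ , m′ = incident⁻ H m in z , m′

  deg≡1⇒≡ : ∀ H {y a b} → deg H y ≡ 1 → arcAt y a ∈ arcs H → arcAt y b ∈ arcs H → a ≡ b
  deg≡1⇒≡ H deg≡1 ma mb = arcAt-injective (length≡1⇒≡ deg≡1 (incident⁺ H ma) (incident⁺ H mb))

  record SecondNeighbour (H : Graph) (y a : ℕ) : Set where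
    field
      other     : ℕ
      other≢    : other ≢ a
      other∈    : arcAt y other ∈ arcs H
      neighbour : ∀ {z} → arcAt y z ∈ arcs H → z ≡ a ⊎ z ≡ other

  second-neighbour : ∀ H {y a} → Unique (arcs H) → deg H y ≡ 2 → arcAt y a ∈ arcs H →
    SecondNeighbour H y a
  second-neighbour H {y} {a} H! deg≡2 ma
    with length≡2⇒other (incident-unique H H!) deg≡2 (incident⁺ H ma)
  ... | e , e≢ , e∈ , only with incident⁻ H e∈
  ... | z , refl , mz = record
    { other     = z
    ; other≢    = λ { refl → e≢ refl }
    ; other∈    = mz
    ; neighbour = λ mz′ → Sum.map arcAt-injective arcAt-injective (only (incident⁺ H mz′))
    }

  neighbours : Graph → ℕ → List ℕ
  neighbours H y = List.map nbr (incident H y)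

  neighbours-singleton : ∀ H {y a} → Unique (arcs H) → arcAt y a ∈ arcs H →
    (∀ {z} → arcAt y z ∈ arcs H → z ≡ a) → neighbours H y ≡ a ∷ []
  neighbours-singleton H {y} {a} H! ma only =
    trans (cong (List.map nbr) (length≡1⇒singleton deg≡1 (incident⁺ H ma)))
          (cong (_∷ []) (nbr-arcAt y a))
    where
    deg≡1 : deg H y ≡ 1
    deg≡1 = length-≡-of-same-members (incident-unique H H!) ([] ∷ [])
      (mk⇔ (λ m → let _ , e≡ , mz = incident⁻ H m in here (trans e≡ (cong (arcAt y) (only mz))))
           (λ { (here refl) → incident⁺ H ma }))

  deg-cong : ∀ H H′ {y} → Unique (arcs H) → Unique (arcs H′) →
    (∀ {z} → arcAt y z ∈ arcs H′ ⇔ arcAt y z ∈ arcs H) → deg H′ y ≡ deg H y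
  deg-cong H H′ H! H′! H′⇔H = length-≡-of-same-members (incident-unique H′ H′!) (incident-unique H H!)
    (mk⇔ (transport H′ H (Equivalence.to H′⇔H)) (transport H H′ (Equivalence.from H′⇔H)))
    where
    transport : ∀ K K′ {y} → (∀ {z} → arcAt y z ∈ arcs K → arcAt y z ∈ arcs K′) →
      ∀ {e} → e ∈ incident K y → e ∈ incident K′ y
    transport K K′ K⊆K′ m with incident⁻ K m
    ... | _ , refl , mz = incident⁺ K′ (K⊆K′ mz)

  deg-replace : ∀ H H′ {y a b} → Unique (arcs H) → Unique (arcs H′) →
    arcAt y a ∈ arcs H → arcAt y b ∉ arcs H →
    (∀ {z} → arcAt y z ∈ arcs H′ ⇔ (z ≡ b ⊎ (arcAt y z ∈ arcs H × z ≢ a))) → deg H′ y ≡ deg H y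
  deg-replace H H′ {y} {a} {b} H! H′! ma b∉H H′⇔ =
    length-≡-of-replacement _≟A_ (incident-unique H H!) (incident-unique H′ H′!)
      (incident⁺ H ma) (λ m → b∉H (incident⊆arcs H m)) (mk⇔ to from)
    where
    to : ∀ {e} → e ∈ incident H′ y → e ≡ arcAt y b ⊎ (e ∈ incident H y × e ≢ arcAt y a)
    to m with incident⁻ H′ m
    ... | z , refl , mz with Equivalence.to H′⇔ mz
    ... | inj₁ refl = inj₁ refl
    ... | inj₂ (mz′ , z≢a) = inj₂ (incident⁺ H mz′ , λ e → z≢a (arcAt-injective e))
    from : ∀ {e} → e ≡ arcAt y b ⊎ (e ∈ incident H y × e ≢ arcAt y a) → e ∈ incident H′ y
    from (inj₁ refl) = incident⁺ H′ (Equivalence.from H′⇔ (inj₁ refl))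
    from (inj₂ (m , e≢)) with incident⁻ H m
    ... | z , refl , mz = incident⁺ H′ (Equivalence.from H′⇔ (inj₂ (mz , λ { refl → e≢ refl })))

  deg-deleteArc : ∀ H {e y} → Unique (arcs H) → y ≢ end e → deg (deleteArc e H) y ≡ deg H y
  deg-deleteArc H {e} {y} H! y≢ = deg-cong H (deleteArc e H) H! (deleteArc-unique H H!)
    (mk⇔ (λ m → proj₁ (∈-deleteArc⁻ H m))
         (λ m → ∈-deleteArc⁺ H m λ { refl → y≢ (sym (end-arcAt y _)) }))

module In = Incidence proj₂ proj₁ (λ y z → z , y) (λ _ _ → refl) (λ _ _ → refl) (λ _ → refl)
module Out = Incidence proj₁ proj₂ (λ y z → y , z) (λ _ _ → refl) (λ _ _ → refl) (λ _ → refl)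

indeg-deleteVertex : ∀ H {r y} → Unique (arcs H) → y ≢ r → (r , y) ∉ arcs H →
  indeg (deleteVertex r H) y ≡ indeg H y
indeg-deleteVertex H H! y≢r ry∉ = In.deg-cong H (deleteVertex _ H) H! (deleteVertex-unique H H!)
  (mk⇔ (λ m → proj₁ (∈-deleteVertex⁻ H m)) (λ m → ∈-deleteVertex⁺ H m (λ { refl → ry∉ m }) y≢r))

outdeg-deleteVertex : ∀ H {r y} → Unique (arcs H) → y ≢ r → (y , r) ∉ arcs H →
  outdeg (deleteVertex r H) y ≡ outdeg H y
outdeg-deleteVertex H H! y≢r yr∉ = Out.deg-cong H (deleteVertex _ H) H! (deleteVertex-unique H H!)
  (mk⇔ (λ m → proj₁ (∈-deleteVertex⁻ H m)) (λ m → ∈-deleteVertex⁺ H m y≢r (λ { refl → yr∉ m })))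

module Suppression (H : Graph) {x a b : ℕ} (H! : Unique (arcs H))
  (ax : (a , x) ∈ arcs H) (parent-x : ∀ {z} → (z , x) ∈ arcs H → z ≡ a)
  (xb : (x , b) ∈ arcs H) (child-x : ∀ {z} → (x , z) ∈ arcs H → z ≡ b)
  (ab∉ : (a , b) ∉ arcs H) where

  S : Graph
  S = suppress x H

  arcs-suppress : arcs S ≡ (a , b) ∷ arcs (deleteVertex x H)
  arcs-suppress rewrite In.neighbours-singleton H H! ax parent-x
                      | Out.neighbours-singleton H H! xb child-x = refl

  ∈-suppress⁻ : ∀ {c d} → (c , d) ∈ arcs S → (c , d) ≡ (a , b) ⊎ ((c , d) ∈ arcs H × c ≢ x × d ≢ x)
  ∈-suppress⁻ m with subst (_ ∈_) arcs-suppress m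
  ... | here e = inj₁ e
  ... | there m′ = inj₂ (∈-deleteVertex⁻ H m′)

  bypass∈ : (a , b) ∈ arcs S
  bypass∈ = subst (_ ∈_) (sym arcs-suppress) (here refl)

  ∈-suppress⁺ : ∀ {c d} → (c , d) ∈ arcs H → c ≢ x → d ≢ x → (c , d) ∈ arcs S
  ∈-suppress⁺ m c≢x d≢x = subst (_ ∈_) (sym arcs-suppress) (there (∈-deleteVertex⁺ H m c≢x d≢x))

  suppress-unique : Unique (arcs S)
  suppress-unique = subst Unique (sym arcs-suppress)
    (¬Any⇒All¬ _ (λ m → ab∉ (proj₁ (∈-deleteVertex⁻ H m))) ∷ deleteVertex-unique H H!)

  indeg-suppress : ∀ {y} → y ≢ x → indeg S y ≡ indeg H y
  indeg-suppress {y} y≢x with y ≟ b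
  ... | yes refl = In.deg-replace H S H! suppress-unique xb ab∉ (mk⇔ to from)
    where
    to : ∀ {z} → (z , b) ∈ arcs S → z ≡ a ⊎ ((z , b) ∈ arcs H × z ≢ x)
    to m with ∈-suppress⁻ m
    ... | inj₁ refl = inj₁ refl
    ... | inj₂ (m′ , z≢x , _) = inj₂ (m′ , z≢x)
    from : ∀ {z} → z ≡ a ⊎ ((z , b) ∈ arcs H × z ≢ x) → (z , b) ∈ arcs S
    from (inj₁ refl) = bypass∈
    from (inj₂ (m , z≢x)) = ∈-suppress⁺ m z≢x y≢x
  ... | no y≢b = In.deg-cong H S H! suppress-unique (mk⇔ to from)
    where
    to : ∀ {z} → (z , y) ∈ arcs S → (z , y) ∈ arcs H
    to m with ∈-suppress⁻ m
    ... | inj₁ refl = ⊥-elim (y≢b refl)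
    ... | inj₂ (m′ , _) = m′
    from : ∀ {z} → (z , y) ∈ arcs H → (z , y) ∈ arcs S
    from m = ∈-suppress⁺ m (λ { refl → y≢b (child-x m) }) y≢x

  outdeg-suppress : ∀ {y} → y ≢ x → outdeg S y ≡ outdeg H y
  outdeg-suppress {y} y≢x with y ≟ a
  ... | yes refl = Out.deg-replace H S H! suppress-unique ax ab∉ (mk⇔ to from)
    where
    to : ∀ {z} → (a , z) ∈ arcs S → z ≡ b ⊎ ((a , z) ∈ arcs H × z ≢ x)
    to m with ∈-suppress⁻ m
    ... | inj₁ refl = inj₁ refl
    ... | inj₂ (m′ , _ , z≢x) = inj₂ (m′ , z≢x)
    from : ∀ {z} → z ≡ b ⊎ ((a , z) ∈ arcs H × z ≢ x) → (a , z) ∈ arcs S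
    from (inj₁ refl) = bypass∈
    from (inj₂ (m , z≢x)) = ∈-suppress⁺ m y≢x z≢x
  ... | no y≢a = Out.deg-cong H S H! suppress-unique (mk⇔ to from)
    where
    to : ∀ {z} → (y , z) ∈ arcs S → (y , z) ∈ arcs H
    to m with ∈-suppress⁻ m
    ... | inj₁ refl = ⊥-elim (y≢a refl)
    ... | inj₂ (m′ , _) = m′
    from : ∀ {z} → (y , z) ∈ arcs H → (y , z) ∈ arcs S
    from m = ∈-suppress⁺ m y≢x (λ { refl → y≢a (parent-x m) })

module _ {G : Graph} where

  _++ᵖ_ : ∀ {x y z j k} → PathLen G x y j → PathLen G y z k → PathLen G x z (j + k)
  here ++ᵖ q = q
  step m p ++ᵖ q = step m (p ++ᵖ q)

  unsnoc : ∀ {x z k} → PathLen G x z (suc k) → ∃ λ y → PathLen G x y k × (y , z) ∈ arcs G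
  unsnoc (step m here) = _ , here , m
  unsnoc (step m (step m′ p)) with unsnoc (step m′ p)
  ... | y , q , yz = y , step m q , yz

  pathLen? : ∀ k x y → Dec (PathLen G x y k)
  pathLen? zero x y with x ≟ y
  ... | yes refl = yes here
  ... | no x≢y = no λ { here → x≢y refl }
  pathLen? (suc k) x y with any? (λ e → (proj₁ e ≟ x) ×-dec pathLen? k (proj₂ e) y) (arcs G)
  ... | no none = no λ { (step m p) → none (lose m (refl , p)) }
  ... | yes some with find some
  ...   | _ , m , refl , p = yes (step m p)

  path-length-bound : ∀ {x z k} (V : List ℕ) → Acyclic G →
    (∀ {w j} → PathLen G x w j → w ∈ V) → PathLen G x z k → k < length V
  path-length-bound V _ inV here with inV here
  ... | here _ = s≤s z≤n
  ... | there _ = s≤s z≤n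
  path-length-bound {x} V acyclic inV (step m p) =
    ≤-trans (s≤s (path-length-bound V∖x acyclic inV∖x p))
      (filter-notAll _ V (Any.map (λ { refl ¬x≡x → ¬x≡x refl }) (inV here)))
    where
    V∖x : List ℕ
    V∖x = filter (λ w → ¬? (w ≟ x)) V
    inV∖x : ∀ {w j} → PathLen G _ w j → w ∈ V∖x
    inV∖x q = ∈-filter⁺ (λ w → ¬? (w ≟ x)) (inV (step m q)) λ { refl → acyclic _ _ (step m q) }

path-lift : ∀ {G H x y k} → (∀ {a b} → (a , b) ∈ arcs H → ∃ (PathLen G a b)) →
  PathLen H x y k → ∃ (PathLen G x y)
path-lift H⇝G here = 0 , here
path-lift H⇝G (step m p) = _ , proj₂ (H⇝G m) ++ᵖ proj₂ (path-lift H⇝G p)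

acyclic-by-paths : ∀ {G H} → Acyclic G →
  (∀ {a b} → (a , b) ∈ arcs H → ∃ λ j → PathLen G a b (suc j)) → Acyclic H
acyclic-by-paths {G} acyclic H⇝G x k (step m p)
  with H⇝G m | path-lift (λ m′ → _ , proj₂ (H⇝G m′)) p
... | _ , step m′ q | _ , r = acyclic x _ (step m′ (q ++ᵖ r))

Least : (ℕ → Set) → Set
Least P = ∃ λ j → P j × ∀ i → P i → j ≤ i

least : ∀ {P : ℕ → Set} → (∀ n → Dec (P n)) → ∀ {k} → P k → Least P
least {P} P? {k} = <-rec (λ k → P k → Least P) search k
  where
  search : ∀ k → (∀ {i} → i < k → P i → Least P) → P k → Least P
  search k smaller pk with anyUpTo? P? k
  ... | yes (i , i<k , pi) = smaller i<k pi
  ... | no none = k , pk , λ i pi → ≮⇒≥ λ i<k → none (i , i<k , pi)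

TreeOrLeaf : Graph → ℕ → Set
TreeOrLeaf G y = IsTreeVertex G y ⊎ IsLeaf G y

treeOrLeaf-transfer : ∀ G H {y} → y ∈ verts H → indeg H y ≡ indeg G y → outdeg H y ≡ outdeg G y →
  TreeOrLeaf G y → TreeOrLeaf H y
treeOrLeaf-transfer _ _ y∈H i o (inj₁ (_ , i′ , o′)) = inj₁ (y∈H , trans i i′ , trans o o′)
treeOrLeaf-transfer _ _ y∈H i o (inj₂ (_ , o′)) = inj₂ (y∈H , trans o o′)

module Network {X G ρ} (N : IsProperNetwork X G ρ) where
  open IsProperNetwork N

  path-target∈verts : ∀ {x y k} → x ∈ verts G → PathLen G x y k → y ∈ verts G
  path-target∈verts x∈G here = x∈G
  path-target∈verts x∈G (step m p) = path-target∈verts (arcsHead m) p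

  arc-irreflexive : ∀ {a b} → (a , b) ∈ arcs G → a ≢ b
  arc-irreflexive ab refl = acyclic _ 0 (step ab here)

  arc-asymmetric : ∀ {a b} → (a , b) ∈ arcs G → (b , a) ∉ arcs G
  arc-asymmetric ab ba = acyclic _ 1 (step ab (step ba here))

  root-no-parent : ∀ {a} → (a , ρ) ∉ arcs G
  root-no-parent = In.deg≡0⇒∉ G rootIndeg

  arc-head≢root : ∀ {a y} → (a , y) ∈ arcs G → y ≢ ρ
  arc-head≢root ay refl = root-no-parent ay

  has-parent : ∀ {y} → y ∈ verts G → y ≢ ρ → ∃ λ a → (a , y) ∈ arcs G
  has-parent {y} y∈G y≢ρ = In.deg≢0⇒∈ G indeg≢0
    where
    indeg≢0 : indeg G y ≢ 0
    indeg≢0 with otherVerts y y∈G y≢ρ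
    ... | inj₁ (i , _) = 1+n≢0 ∘ trans (sym i)
    ... | inj₂ (inj₁ (i , _)) = 1+n≢0 ∘ trans (sym i)
    ... | inj₂ (inj₂ (i , _)) = 1+n≢0 ∘ trans (sym i)

  -- Walking backwards along parents either reaches the root or yields paths of every
  -- length, which acyclicity forbids (path-length-bound).
  walk-back : ∀ n {y} → y ∈ verts G → ∃ (PathLen G ρ y) ⊎ ∃ λ z → z ∈ verts G × PathLen G z y n
  walk-back zero y∈G = inj₂ (_ , y∈G , here)
  walk-back (suc n) y∈G with walk-back n y∈G
  ... | inj₁ reached = inj₁ reached
  ... | inj₂ (z , z∈G , p) with z ≟ ρ
  ...   | yes refl = inj₁ (n , p)
  ...   | no z≢ρ = let a , az = has-parent z∈G z≢ρ in inj₂ (a , arcsTail az , step az p)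

  reachable : ∀ {y} → y ∈ verts G → ∃ (PathLen G ρ y)
  reachable y∈G with walk-back (length (verts G)) y∈G
  ... | inj₁ reached = reached
  ... | inj₂ (z , z∈G , p) =
    ⊥-elim (<-irrefl refl (path-length-bound (verts G) acyclic (path-target∈verts z∈G) p))

  distance : ∀ {y} → y ∈ verts G → ∃ (IsDist G ρ y)
  distance y∈G = least (λ k → pathLen? k ρ _) (proj₂ (reachable y∈G))

  only-parent-closer : ∀ {p y dp dy} → (p , y) ∈ arcs G → (∀ {z} → (z , y) ∈ arcs G → z ≡ p) →
    IsDist G ρ p dp → IsDist G ρ y dy → dp < dy
  only-parent-closer py _ _ (here , _) = ⊥-elim (root-no-parent py)
  only-parent-closer py only-p (_ , shortest) (step m q , _) with unsnoc (step m q)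
  ... | z , q′ , zy with only-p zy
  ...   | refl = s≤s (shortest _ q′)

  two-parents⇒reticulation : ∀ {a b y} → (a , y) ∈ arcs G → (b , y) ∈ arcs G → a ≢ b →
    IsReticulation G y
  two-parents⇒reticulation {y = y} ay by a≢b with otherVerts y (arcsHead ay) (arc-head≢root ay)
  ... | inj₁ (i , _) = ⊥-elim (a≢b (In.deg≡1⇒≡ G i ay by))
  ... | inj₂ (inj₁ (i , _)) = ⊥-elim (a≢b (In.deg≡1⇒≡ G i ay by))
  ... | inj₂ (inj₂ (i , o)) = arcsHead ay , i , o

  reticulation⇒¬treeOrLeaf : ∀ {y} → IsReticulation G y → ¬ TreeOrLeaf G y
  reticulation⇒¬treeOrLeaf (_ , i , _) (inj₁ (_ , i′ , _)) = contradiction (trans (sym i) i′) λ ()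
  reticulation⇒¬treeOrLeaf (_ , _ , o) (inj₂ (_ , o′)) = contradiction (trans (sym o) o′) λ ()

  parent-unique : ∀ {a b y} → ¬ IsReticulation G y → (a , y) ∈ arcs G → (b , y) ∈ arcs G → a ≡ b
  parent-unique {a} {b} ¬ret ay by with a ≟ b
  ... | yes a≡b = a≡b
  ... | no a≢b = ⊥-elim (¬ret (two-parents⇒reticulation ay by a≢b))

  bypass-triangle : ∀ {a m b x} → (a , m) ∈ arcs G → (m , b) ∈ arcs G →
    (∀ {z} → (z , b) ∈ arcs G → z ≡ m) → x ≢ m → Adj G b x → Adj G x a → IsReticulationArc G (a , x)
  bypass-triangle _ _ parent-b x≢m (inj₂ xb) _ = ⊥-elim (x≢m (parent-b xb))
  bypass-triangle am mb _ _ (inj₁ bx) (inj₁ xa) =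
    ⊥-elim (acyclic _ 3 (step am (step mb (step bx (step xa here)))))
  bypass-triangle am mb _ _ (inj₁ bx) (inj₂ ax) =
    ax , two-parents⇒reticulation ax bx λ { refl → arc-asymmetric am mb }

module TreeChildNetwork {X G ρ} (N : IsProperNetwork X G ρ) (tc : IsTreeChild G) where
  open IsProperNetwork N
  open Network N

  reticulation-tail-outdeg : ∀ {y r} → IsReticulationArc G (y , r) → outdeg G y ≡ 2
  reticulation-tail-outdeg {y} (yr , r-ret) with y ≟ ρ
  ... | yes refl = rootOutdeg
  ... | no y≢ρ with otherVerts y (arcsTail yr) y≢ρ
  ...   | inj₁ (_ , o) = ⊥-elim (Out.deg≡0⇒∉ G o yr)
  ...   | inj₂ (inj₁ (_ , o)) = o
  ...   | inj₂ (inj₂ (_ , o)) with tc y (arcsTail yr) (λ o′ → 1+n≢0 (trans (sym o) o′))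
  ...     | t , yt , t-tl =
    ⊥-elim (reticulation⇒¬treeOrLeaf r-ret (subst (TreeOrLeaf G) (Out.deg≡1⇒≡ G o yt yr) t-tl))

  record Sibling (y r : ℕ) : Set where
    field
      sibling    : ℕ
      sibling≢   : sibling ≢ r
      sibling∈   : (y , sibling) ∈ arcs G
      treeOrLeaf : TreeOrLeaf G sibling
      child      : ∀ {z} → (y , z) ∈ arcs G → z ≡ r ⊎ z ≡ sibling

  sibling : ∀ {y r} → IsReticulationArc G (y , r) → Sibling y r
  sibling {y} ret@(yr , r-ret) = record
    { sibling = other ; sibling≢ = other≢ ; sibling∈ = other∈ ; treeOrLeaf = other-tl
    ; child = neighbour }
    where
    outdeg≡2 : outdeg G y ≡ 2
    outdeg≡2 = reticulation-tail-outdeg ret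
    open Out.SecondNeighbour (Out.second-neighbour G noParallel outdeg≡2 yr)
    other-tl : TreeOrLeaf G other
    other-tl with tc y (arcsTail yr) (λ o → 1+n≢0 (trans (sym outdeg≡2) o))
    ... | t , yt , t-tl with neighbour yt
    ...   | inj₁ refl = ⊥-elim (reticulation⇒¬treeOrLeaf r-ret t-tl)
    ...   | inj₂ refl = t-tl

  reticulation-child-unique : ∀ {y r r′} → IsReticulationArc G (y , r) → IsReticulationArc G (y , r′) →
    r′ ≡ r
  reticulation-child-unique ret (yr′ , r′-ret) with Sibling.child (sibling ret) yr′
  ... | inj₁ r′≡r = r′≡r
  ... | inj₂ refl = ⊥-elim (reticulation⇒¬treeOrLeaf r′-ret (Sibling.treeOrLeaf (sibling ret)))

module ArcDeletion {X G ρ u v} (N : IsProperNetwork X G ρ) (tc : IsTreeChild G)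
  (no3 : ¬ HasThreeCycle G) (uv-ret : IsReticulationArc G (u , v))
  (closest : ∀ u′ v′ d d′ → IsReticulationArc G (u′ , v′) →
    IsDist G ρ u d → IsDist G ρ u′ d′ → d ≤ d′) where
  open IsProperNetwork N
  open Network N
  open TreeChildNetwork N tc

  uv : (u , v) ∈ arcs G
  uv = proj₁ uv-ret

  v-ret : IsReticulation G v
  v-ret = proj₂ uv-ret

  open In.SecondNeighbour (In.second-neighbour G noParallel (proj₁ (proj₂ v-ret)) uv)
    renaming (other to q; other≢ to q≢u; other∈ to qv; neighbour to parent-v)

  open Sibling (sibling uv-ret)
    renaming (sibling to c; sibling≢ to c≢v; sibling∈ to uc; treeOrLeaf to c-treeOrLeaf; child to child-u)

  v-child : ∃ λ w → (v , w) ∈ arcs G × TreeOrLeaf G w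
  v-child = tc v (proj₁ v-ret) (λ o → 1+n≢0 (trans (sym (proj₂ (proj₂ v-ret))) o))

  w : ℕ
  w = proj₁ v-child

  vw : (v , w) ∈ arcs G
  vw = proj₁ (proj₂ v-child)

  child-v : ∀ {z} → (v , z) ∈ arcs G → z ≡ w
  child-v vz = Out.deg≡1⇒≡ G (proj₂ (proj₂ v-ret)) vz vw

  parent-w : ∀ {z} → (z , w) ∈ arcs G → z ≡ v
  parent-w zw = parent-unique (λ ret → reticulation⇒¬treeOrLeaf ret (proj₂ (proj₂ v-child))) zw vw

  parent-c : ∀ {z} → (z , c) ∈ arcs G → z ≡ u
  parent-c zc = parent-unique (λ ret → reticulation⇒¬treeOrLeaf ret c-treeOrLeaf) zc uc

  parent-u-unique : ∀ {a b} → (a , u) ∈ arcs G → (b , u) ∈ arcs G → a ≡ b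
  parent-u-unique = parent-unique λ (_ , _ , o) →
    contradiction (trans (sym o) (reticulation-tail-outdeg uv-ret)) λ ()

  triangle : ∀ {a b x} → a ≢ b → b ≢ x → a ≢ x → Adj G a b → Adj G b x → Adj G x a → ⊥
  triangle a≢b b≢x a≢x ab bx xa = no3 (_ , _ , _ , a≢b , b≢x , a≢x , ab , bx , xa)

  u≢v : u ≢ v
  u≢v = arc-irreflexive uv

  q≢v : q ≢ v
  q≢v = arc-irreflexive qv

  c≢u : c ≢ u
  c≢u = arc-irreflexive uc ∘ sym

  w≢v : w ≢ v
  w≢v = arc-irreflexive vw ∘ sym

  w≢u : w ≢ u
  w≢u w≡u = arc-asymmetric uv (subst (λ t → (v , t) ∈ arcs G) w≡u vw)

  q≢w : q ≢ w
  q≢w q≡w = arc-asymmetric qv (subst (λ t → (v , t) ∈ arcs G) (sym q≡w) vw)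

  c≢w : c ≢ w
  c≢w c≡w = triangle u≢v (w≢v ∘ sym) (w≢u ∘ sym) (inj₁ uv) (inj₁ vw)
    (inj₂ (subst (λ t → (u , t) ∈ arcs G) c≡w uc))

  c≢q : c ≢ q
  c≢q c≡q = triangle (c≢u ∘ sym) c≢v u≢v (inj₁ uc)
    (inj₁ (subst (λ t → (t , v) ∈ arcs G) (sym c≡q) qv)) (inj₂ uv)

  qw∉ : (q , w) ∉ arcs G
  qw∉ qw = triangle q≢v (w≢v ∘ sym) q≢w (inj₁ qv) (inj₁ vw) (inj₂ qw)

  q-not-parent-of-u : (q , u) ∉ arcs G
  q-not-parent-of-u qu = triangle q≢u u≢v q≢v (inj₁ qu) (inj₁ uv) (inj₂ qv)

  w-not-parent-of-u : (w , u) ∉ arcs G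
  w-not-parent-of-u wu = acyclic _ 2 (step uv (step vw (step wu here)))

  parent-of-u≢v : ∀ {a} → (a , u) ∈ arcs G → a ≢ v
  parent-of-u≢v au refl = arc-asymmetric uv au

  parent-of-u-not-parent-of-c : ∀ {a} → (a , u) ∈ arcs G → (a , c) ∉ arcs G
  parent-of-u-not-parent-of-c au ac =
    triangle (arc-irreflexive au) (c≢u ∘ sym) (λ { refl → arc-asymmetric uc au })
      (inj₁ au) (inj₁ uc) (inj₂ ac)

  parent-of-u-not-reticulation-tail : ∀ {a x} → (a , u) ∈ arcs G → ¬ IsReticulationArc G (a , x)
  parent-of-u-not-reticulation-tail {a} {x} au ret with distance (arcsTail au) | distance (arcsTail uv)
  ... | da , Da | du , Du =
    ≤⇒≯ (closest a x du da ret Du Da) (only-parent-closer au (λ zu → parent-u-unique zu au) Da Du)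

  Kept : ℕ → ℕ → Set
  Kept a b = (a , b) ∈ arcs G × a ≢ u × a ≢ v × b ≢ u × b ≢ v

  -- Suppressing v creates (q , w); suppressing u creates (p , c) for the parent p of u.
  -- Quantifying over all parents of u also covers the case where u is the root.
  Added : ℕ → ℕ → Set
  Added a b = (a , b) ≡ (q , w) ⊎ ((a , u) ∈ arcs G × b ≡ c)

  AdjKept AdjAdded : ℕ → ℕ → Set
  AdjKept a b = Kept a b ⊎ Kept b a
  AdjAdded a b = Added a b ⊎ Added b a

  kept⇒adj : ∀ {a b} → AdjKept a b → Adj G a b
  kept⇒adj = Sum.map proj₁ proj₁

  kept-target : ∀ {a b} → AdjKept a b → b ≢ u × b ≢ v
  kept-target (inj₁ (_ , _ , _ , b≢u , b≢v)) = b≢u , b≢v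
  kept-target (inj₂ (_ , b≢u , b≢v , _ , _)) = b≢u , b≢v

  added-tail-not-head : ∀ {a b x} → Added a b → ¬ Added b x
  added-tail-not-head (inj₁ refl) (inj₁ e) = q≢w (sym (cong proj₁ e))
  added-tail-not-head (inj₁ refl) (inj₂ (wu , _)) = w-not-parent-of-u wu
  added-tail-not-head (inj₂ (_ , refl)) (inj₁ e) = c≢q (cong proj₁ e)
  added-tail-not-head (inj₂ (_ , refl)) (inj₂ (cu , _)) = arc-asymmetric uc cu

  added-same-head : ∀ {a b x} → Added a b → Added x b → a ≡ x
  added-same-head (inj₁ refl) (inj₁ e) = sym (cong proj₁ e)
  added-same-head (inj₁ refl) (inj₂ (_ , w≡c)) = ⊥-elim (c≢w (sym w≡c))
  added-same-head (inj₂ (_ , refl)) (inj₁ e) = ⊥-elim (c≢w (cong proj₂ e))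
  added-same-head (inj₂ (au , refl)) (inj₂ (xu , _)) = parent-u-unique au xu

  added-same-tail : ∀ {a b x} → Added a b → Added a x → b ≡ x
  added-same-tail (inj₁ refl) (inj₁ e) = sym (cong proj₂ e)
  added-same-tail (inj₁ refl) (inj₂ (qu , _)) = ⊥-elim (q-not-parent-of-u qu)
  added-same-tail (inj₂ (qu , _)) (inj₁ refl) = ⊥-elim (q-not-parent-of-u qu)
  added-same-tail (inj₂ (_ , refl)) (inj₂ (_ , refl)) = refl

  -- The added arcs form a matching, so a triangle contains at most one of them.
  added-matching : ∀ {a b x} → AdjAdded a b → AdjAdded b x → a ≡ x
  added-matching (inj₁ ab) (inj₁ bx) = ⊥-elim (added-tail-not-head ab bx)
  added-matching (inj₁ ab) (inj₂ xb) = added-same-head ab xb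
  added-matching (inj₂ ba) (inj₁ bx) = added-same-tail ba bx
  added-matching (inj₂ ba) (inj₂ xb) = ⊥-elim (added-tail-not-head xb ba)

  added-in-kept-triangle : ∀ {a b x} → Added a b → AdjKept b x → AdjKept x a → ⊥
  added-in-kept-triangle {x = x} (inj₁ refl) wx xq = x≢v (reticulation-child-unique (qv , v-ret) qx-ret)
    where
    x≢v : x ≢ v
    x≢v = proj₂ (kept-target wx)
    qx-ret : IsReticulationArc G (q , x)
    qx-ret = bypass-triangle qv vw parent-w x≢v (kept⇒adj wx) (kept⇒adj xq)
  added-in-kept-triangle (inj₂ (au , refl)) cx xa =
    parent-of-u-not-reticulation-tail au
      (bypass-triangle au uc parent-c (proj₁ (kept-target cx)) (kept⇒adj cx) (kept⇒adj xa))

  record IsArcDeletion (H : Graph) (ρ′ : ℕ) : Set where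
    field
      verts-unique : Unique (verts H)
      arcs-unique  : Unique (arcs H)
      verts⁻       : ∀ {y} → y ∈ verts H → y ∈ verts G × y ≢ u × y ≢ v
      verts⁺       : ∀ {y} → y ∈ verts G → y ≢ u → y ≢ v → y ∈ verts H
      arcs⁻        : ∀ {a b} → (a , b) ∈ arcs H → Kept a b ⊎ Added a b
      kept⁺        : ∀ {a b} → Kept a b → (a , b) ∈ arcs H
      bypass⁺      : ∀ {a} → (a , u) ∈ arcs G → (a , c) ∈ arcs H
      indeg-≡      : ∀ {y} → y ≢ u → y ≢ v → y ≢ ρ′ → indeg H y ≡ indeg G y
      outdeg-≡     : ∀ {y} → y ≢ u → y ≢ v → outdeg H y ≡ outdeg G y
      root∈verts   : ρ′ ∈ verts H
      root-indeg   : indeg H ρ′ ≡ 0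
      root-outdeg  : outdeg H ρ′ ≡ 2
      root-moved   : ρ′ ≡ ρ ⊎ u ≡ ρ

  module Properties {H ρ′} (D : IsArcDeletion H ρ′) where
    open IsArcDeletion D

    endpoints∈verts : ∀ {a b} → (a , b) ∈ arcs H → a ∈ verts H × b ∈ verts H
    endpoints∈verts ab with arcs⁻ ab
    ... | inj₁ (ab′ , a≢u , a≢v , b≢u , b≢v) =
      verts⁺ (arcsTail ab′) a≢u a≢v , verts⁺ (arcsHead ab′) b≢u b≢v
    ... | inj₂ (inj₁ refl) = verts⁺ (arcsTail qv) q≢u q≢v , verts⁺ (arcsHead vw) w≢u w≢v
    ... | inj₂ (inj₂ (au , refl)) =
      verts⁺ (arcsTail au) (arc-irreflexive au) (parent-of-u≢v au) , verts⁺ (arcsHead uc) c≢u c≢v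

    arc⇝path : ∀ {a b} → (a , b) ∈ arcs H → ∃ λ j → PathLen G a b (suc j)
    arc⇝path ab with arcs⁻ ab
    ... | inj₁ (ab′ , _) = 0 , step ab′ here
    ... | inj₂ (inj₁ refl) = 1 , step qv (step vw here)
    ... | inj₂ (inj₂ (au , refl)) = 1 , step au (step uc here)

    ≢root : ∀ {y} → y ∈ verts H → y ≢ ρ′ → y ≢ ρ
    ≢root {y} y∈H y≢ρ′ with root-moved
    ... | inj₁ refl = y≢ρ′
    ... | inj₂ refl = proj₁ (proj₂ (verts⁻ y∈H))

    other-vertex : ∀ y → y ∈ verts H → y ≢ ρ′ →
        (indeg H y ≡ 1 × outdeg H y ≡ 0)
      ⊎ (indeg H y ≡ 1 × outdeg H y ≡ 2)
      ⊎ (indeg H y ≡ 2 × outdeg H y ≡ 1)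
    other-vertex y y∈H y≢ρ′ with verts⁻ y∈H
    ... | y∈G , y≢u , y≢v rewrite indeg-≡ y≢u y≢v y≢ρ′ | outdeg-≡ y≢u y≢v =
      otherVerts y y∈G (≢root y∈H y≢ρ′)

    leaf⇔ : ∀ y → IsLeaf H y ⇔ IsLeaf G y
    leaf⇔ y = mk⇔ to from
      where
      to : IsLeaf H y → IsLeaf G y
      to (y∈H , o) = let y∈G , y≢u , y≢v = verts⁻ y∈H in y∈G , trans (sym (outdeg-≡ y≢u y≢v)) o
      from : IsLeaf G y → IsLeaf H y
      from (y∈G , o) = verts⁺ y∈G y≢u y≢v , trans (outdeg-≡ y≢u y≢v) o
        where
        y≢u : y ≢ u
        y≢u refl = contradiction (trans (sym o) (reticulation-tail-outdeg uv-ret)) λ ()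
        y≢v : y ≢ v
        y≢v refl = contradiction (trans (sym o) (proj₂ (proj₂ v-ret))) λ ()

    isProperNetwork : IsProperNetwork X H ρ′
    isProperNetwork = record
      { vertsUnique = verts-unique
      ; noParallel  = arcs-unique
      ; arcsTail    = proj₁ ∘ endpoints∈verts
      ; arcsHead    = proj₂ ∘ endpoints∈verts
      ; acyclic     = acyclic-by-paths acyclic arc⇝path
      ; rootVert    = root∈verts
      ; rootIndeg   = root-indeg
      ; rootOutdeg  = root-outdeg
      ; otherVerts  = other-vertex
      ; leavesAreX  = λ y → ⇔.trans (leaf⇔ y) (leavesAreX y)
      ; XNonEmpty   = XNonEmpty
      }

    treeOrLeaf⁺ : ∀ {a t} → (a , t) ∈ arcs H → t ≢ u → t ≢ v → TreeOrLeaf G t → TreeOrLeaf H t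
    treeOrLeaf⁺ at t≢u t≢v = treeOrLeaf-transfer G H (proj₂ (endpoints∈verts at))
      (indeg-≡ t≢u t≢v λ { refl → In.deg≡0⇒∉ H root-indeg at }) (outdeg-≡ t≢u t≢v)

    isTreeChild : IsTreeChild H
    isTreeChild x x∈H outdeg≢0 with verts⁻ x∈H
    ... | x∈G , x≢u , x≢v with tc x x∈G (outdeg≢0 ∘ trans (outdeg-≡ x≢u x≢v))
    ...   | t , xt , t-tl with t ≟ u | t ≟ v
    ...     | yes refl | _ = c , bypass⁺ xt , treeOrLeaf⁺ (bypass⁺ xt) c≢u c≢v c-treeOrLeaf
    ...     | no _ | yes refl = ⊥-elim (reticulation⇒¬treeOrLeaf v-ret t-tl)
    ...     | no t≢u | no t≢v = t , xt′ , treeOrLeaf⁺ xt′ t≢u t≢v t-tl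
      where
      xt′ : (x , t) ∈ arcs H
      xt′ = kept⁺ (xt , x≢u , x≢v , t≢u , t≢v)

    adj⁻ : ∀ {a b} → Adj H a b → AdjKept a b ⊎ AdjAdded a b
    adj⁻ (inj₁ ab) = Sum.map inj₁ inj₁ (arcs⁻ ab)
    adj⁻ (inj₂ ba) = Sum.map inj₂ inj₂ (arcs⁻ ba)

    kept-of-not-added : ∀ {a b} → Adj H a b → ¬ AdjAdded a b → AdjKept a b
    kept-of-not-added ab ¬added with adj⁻ ab
    ... | inj₁ kept = kept
    ... | inj₂ added = ⊥-elim (¬added added)

    triangle-with-added : ∀ {a b x} → b ≢ x → a ≢ x →
      AdjAdded a b → Adj H b x → Adj H x a → ⊥
    triangle-with-added {a} {b} {x} b≢x a≢x ab bx xa = added-edge ab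
      where
      bx′ : AdjKept b x
      bx′ = kept-of-not-added bx (a≢x ∘ added-matching ab)
      xa′ : AdjKept x a
      xa′ = kept-of-not-added xa (λ xa″ → b≢x (sym (added-matching xa″ ab)))
      added-edge : AdjAdded a b → ⊥
      added-edge (inj₁ ab′) = added-in-kept-triangle ab′ bx′ xa′
      added-edge (inj₂ ba′) = added-in-kept-triangle ba′ (Sum.swap xa′) (Sum.swap bx′)

    noThreeCycle : ¬ HasThreeCycle H
    noThreeCycle (a , b , x , a≢b , b≢x , a≢x , ab , bx , xa) with adj⁻ ab | adj⁻ bx | adj⁻ xa
    ... | inj₂ ab′ | _ | _ = triangle-with-added b≢x a≢x ab′ bx xa
    ... | _ | inj₂ bx′ | _ = triangle-with-added (a≢x ∘ sym) (a≢b ∘ sym) bx′ xa ab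
    ... | _ | _ | inj₂ xa′ = triangle-with-added a≢b (b≢x ∘ sym) xa′ ab bx
    ... | inj₁ ab′ | inj₁ bx′ | inj₁ xa′ =
      triangle a≢b b≢x a≢x (kept⇒adj ab′) (kept⇒adj bx′) (kept⇒adj xa′)

    treeChild∧no3Cycle : Σ ℕ (λ ρ″ → IsTreeChildNetwork X H ρ″) × ¬ HasThreeCycle H
    treeChild∧no3Cycle = (ρ′ , inj₂ isProperNetwork , isTreeChild) , noThreeCycle

  G₁ : Graph
  G₁ = deleteArc (u , v) G

  G₁! : Unique (arcs G₁)
  G₁! = deleteArc-unique G noParallel

  ∈G₁ : ∀ {a b} → (a , b) ∈ arcs G₁ → (a , b) ∈ arcs G
  ∈G₁ m = proj₁ (∈-deleteArc⁻ G m)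

  kept∈G₁ : ∀ {a b} → (a , b) ∈ arcs G → a ≢ u → (a , b) ∈ arcs G₁
  kept∈G₁ ab a≢u = ∈-deleteArc⁺ G ab (a≢u ∘ cong proj₁)

  module NonRoot (u≢ρ : u ≢ ρ) where
    p : ℕ
    p = proj₁ (has-parent (arcsTail uv) u≢ρ)

    pu : (p , u) ∈ arcs G
    pu = proj₂ (has-parent (arcsTail uv) u≢ρ)

    p≢v : p ≢ v
    p≢v = parent-of-u≢v pu

    child-u₁ : ∀ {z} → (u , z) ∈ arcs G₁ → z ≡ c
    child-u₁ uz with ∈-deleteArc⁻ G uz
    ... | uz′ , uz≢uv with child-u uz′
    ...   | inj₁ refl = ⊥-elim (uz≢uv refl)
    ...   | inj₂ z≡c = z≡c

    module S₁ = Suppression G₁ G₁!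
      (∈-deleteArc⁺ G pu (u≢v ∘ cong proj₂)) (λ zu → parent-u-unique (∈G₁ zu) pu)
      (∈-deleteArc⁺ G uc (c≢v ∘ cong proj₂)) child-u₁
      (parent-of-u-not-parent-of-c pu ∘ ∈G₁)

    G₂ : Graph
    G₂ = suppress u G₁

    kept∈G₂ : ∀ {a b} → (a , b) ∈ arcs G → a ≢ u → b ≢ u → (a , b) ∈ arcs G₂
    kept∈G₂ ab a≢u b≢u = S₁.∈-suppress⁺ (kept∈G₁ ab a≢u) a≢u b≢u

    parent-v₂ : ∀ {z} → (z , v) ∈ arcs G₂ → z ≡ q
    parent-v₂ zv with S₁.∈-suppress⁻ zv
    ... | inj₁ e = ⊥-elim (c≢v (sym (cong proj₂ e)))
    ... | inj₂ (zv′ , z≢u , _) with parent-v (∈G₁ zv′)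
    ...   | inj₁ z≡u = ⊥-elim (z≢u z≡u)
    ...   | inj₂ z≡q = z≡q

    child-v₂ : ∀ {z} → (v , z) ∈ arcs G₂ → z ≡ w
    child-v₂ vz with S₁.∈-suppress⁻ vz
    ... | inj₁ e = ⊥-elim (p≢v (sym (cong proj₁ e)))
    ... | inj₂ (vz′ , _) = child-v (∈G₁ vz′)

    qw∉G₂ : (q , w) ∉ arcs G₂
    qw∉G₂ qw with S₁.∈-suppress⁻ qw
    ... | inj₁ e = c≢w (sym (cong proj₂ e))
    ... | inj₂ (qw′ , _) = qw∉ (∈G₁ qw′)

    module S₂ = Suppression G₂ S₁.suppress-unique
      (kept∈G₂ qv q≢u (u≢v ∘ sym)) parent-v₂ (kept∈G₂ vw (u≢v ∘ sym) w≢u) child-v₂ qw∉G₂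

    G₃ : Graph
    G₃ = suppress v G₂

    verts⁻ : ∀ {y} → y ∈ verts G₃ → y ∈ verts G × y ≢ u × y ≢ v
    verts⁻ y∈G₃ with ∈-verts-deleteVertex⁻ G₂ y∈G₃
    ... | y∈G₂ , y≢v with ∈-verts-deleteVertex⁻ G₁ y∈G₂
    ...   | y∈G , y≢u = y∈G , y≢u , y≢v

    verts⁺ : ∀ {y} → y ∈ verts G → y ≢ u → y ≢ v → y ∈ verts G₃
    verts⁺ y∈G y≢u y≢v = ∈-verts-deleteVertex⁺ G₂ (∈-verts-deleteVertex⁺ G₁ y∈G y≢u) y≢v

    arcs⁻ : ∀ {a b} → (a , b) ∈ arcs G₃ → Kept a b ⊎ Added a b
    arcs⁻ ab with S₂.∈-suppress⁻ ab
    ... | inj₁ refl = inj₂ (inj₁ refl)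
    ... | inj₂ (ab′ , a≢v , b≢v) with S₁.∈-suppress⁻ ab′
    ...   | inj₁ refl = inj₂ (inj₂ (pu , refl))
    ...   | inj₂ (ab″ , a≢u , b≢u) = inj₁ (∈G₁ ab″ , a≢u , a≢v , b≢u , b≢v)

    indeg-preserved : ∀ {y} → y ≢ u → y ≢ v → indeg G₃ y ≡ indeg G y
    indeg-preserved y≢u y≢v =
      trans (S₂.indeg-suppress y≢v) (trans (S₁.indeg-suppress y≢u) (In.deg-deleteArc G noParallel y≢v))

    outdeg-preserved : ∀ {y} → y ≢ u → y ≢ v → outdeg G₃ y ≡ outdeg G y
    outdeg-preserved y≢u y≢v =
      trans (S₂.outdeg-suppress y≢v) (trans (S₁.outdeg-suppress y≢u) (Out.deg-deleteArc G noParallel y≢u))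

    ρ≢u : ρ ≢ u
    ρ≢u = u≢ρ ∘ sym

    ρ≢v : ρ ≢ v
    ρ≢v = arc-head≢root uv ∘ sym

    deletion : IsArcDeletion G₃ ρ
    deletion = record
      { verts-unique = deleteVertex-uniqueVerts G₂ (deleteVertex-uniqueVerts G₁ vertsUnique)
      ; arcs-unique  = S₂.suppress-unique
      ; verts⁻       = verts⁻
      ; verts⁺       = verts⁺
      ; arcs⁻        = arcs⁻
      ; kept⁺        = λ (ab , a≢u , a≢v , b≢u , b≢v) → S₂.∈-suppress⁺ (kept∈G₂ ab a≢u b≢u) a≢v b≢v
      ; bypass⁺      = λ au → subst (λ a → (a , c) ∈ arcs G₃) (parent-u-unique pu au)
                                (S₂.∈-suppress⁺ S₁.bypass∈ p≢v c≢v)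
      ; indeg-≡      = λ y≢u y≢v _ → indeg-preserved y≢u y≢v
      ; outdeg-≡     = outdeg-preserved
      ; root∈verts   = verts⁺ rootVert ρ≢u ρ≢v
      ; root-indeg   = trans (indeg-preserved ρ≢u ρ≢v) rootIndeg
      ; root-outdeg  = trans (outdeg-preserved ρ≢u ρ≢v) rootOutdeg
      ; root-moved   = inj₁ refl
      }

  module Root (u≡ρ : u ≡ ρ) where
    u-no-parent : ∀ {a} → (a , u) ∉ arcs G
    u-no-parent au = root-no-parent (subst (λ t → (_ , t) ∈ arcs G) u≡ρ au)

    parent-v₁ : ∀ {z} → (z , v) ∈ arcs G₁ → z ≡ q
    parent-v₁ zv with ∈-deleteArc⁻ G zv
    ... | zv′ , zv≢uv with parent-v zv′
    ...   | inj₁ refl = ⊥-elim (zv≢uv refl)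
    ...   | inj₂ z≡q = z≡q

    module S₁ = Suppression G₁ G₁!
      (kept∈G₁ qv q≢u) parent-v₁ (kept∈G₁ vw (u≢v ∘ sym)) (child-v ∘ ∈G₁) (qw∉ ∘ ∈G₁)

    G₂ : Graph
    G₂ = suppress v G₁

    G₃ : Graph
    G₃ = deleteVertex u G₂

    verts⁻ : ∀ {y} → y ∈ verts G₃ → y ∈ verts G × y ≢ u × y ≢ v
    verts⁻ y∈G₃ with ∈-verts-deleteVertex⁻ G₂ y∈G₃
    ... | y∈G₂ , y≢u with ∈-verts-deleteVertex⁻ G₁ y∈G₂
    ...   | y∈G , y≢v = y∈G , y≢u , y≢v

    verts⁺ : ∀ {y} → y ∈ verts G → y ≢ u → y ≢ v → y ∈ verts G₃
    verts⁺ y∈G y≢u y≢v = ∈-verts-deleteVertex⁺ G₂ (∈-verts-deleteVertex⁺ G₁ y∈G y≢v) y≢u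

    arcs⁻ : ∀ {a b} → (a , b) ∈ arcs G₃ → Kept a b ⊎ Added a b
    arcs⁻ ab with ∈-deleteVertex⁻ G₂ ab
    ... | ab′ , a≢u , b≢u with S₁.∈-suppress⁻ ab′
    ...   | inj₁ refl = inj₂ (inj₁ refl)
    ...   | inj₂ (ab″ , a≢v , b≢v) = inj₁ (∈G₁ ab″ , a≢u , a≢v , b≢u , b≢v)

    no-arc-into-u : ∀ {y} → (y , u) ∉ arcs G₂
    no-arc-into-u yu with S₁.∈-suppress⁻ yu
    ... | inj₁ e = w≢u (sym (cong proj₂ e))
    ... | inj₂ (yu′ , _) = u-no-parent (∈G₁ yu′)

    no-arc-from-u : ∀ {y} → y ≢ c → (u , y) ∉ arcs G₂
    no-arc-from-u y≢c uy with S₁.∈-suppress⁻ uy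
    ... | inj₁ e = q≢u (sym (cong proj₁ e))
    ... | inj₂ (uy′ , _) with ∈-deleteArc⁻ G uy′
    ...   | uy″ , uy≢uv with child-u uy″
    ...     | inj₁ refl = uy≢uv refl
    ...     | inj₂ y≡c = y≢c y≡c

    indeg-preserved : ∀ {y} → y ≢ u → y ≢ v → y ≢ c → indeg G₃ y ≡ indeg G y
    indeg-preserved y≢u y≢v y≢c =
      trans (indeg-deleteVertex G₂ S₁.suppress-unique y≢u (no-arc-from-u y≢c))
        (trans (S₁.indeg-suppress y≢v) (In.deg-deleteArc G noParallel y≢v))

    outdeg-preserved : ∀ {y} → y ≢ u → y ≢ v → outdeg G₃ y ≡ outdeg G y
    outdeg-preserved y≢u y≢v =
      trans (outdeg-deleteVertex G₂ S₁.suppress-unique y≢u no-arc-into-u)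
        (trans (S₁.outdeg-suppress y≢v) (Out.deg-deleteArc G noParallel y≢u))

    -- A path from the root u to q cannot start with (u , v), which would close a cycle
    -- with (q , v); so it passes through c, and c is not a leaf.
    c-tree : IsTreeVertex G c
    c-tree with c-treeOrLeaf
    ... | inj₁ tree = tree
    ... | inj₂ (_ , o) with reachable (arcsTail qv)
    ...   | k , ρ⇝q = ⊥-elim (no-path refl (subst (λ s → PathLen G s q k) (sym u≡ρ) ρ⇝q))
      where
      no-path : ∀ {t k} → t ≡ q → ¬ PathLen G u t k
      no-path t≡q here = q≢u (sym t≡q)
      no-path t≡q (step uy p) with child-u uy
      ... | inj₁ refl = acyclic _ _ (step qv (subst (λ t → PathLen G v t _) t≡q p))
      ... | inj₂ refl with p
      ...   | here = c≢q t≡q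
      ...   | step cz _ = Out.deg≡0⇒∉ G o cz

    deletion : IsArcDeletion G₃ c
    deletion = record
      { verts-unique = deleteVertex-uniqueVerts G₂ (deleteVertex-uniqueVerts G₁ vertsUnique)
      ; arcs-unique  = deleteVertex-unique G₂ S₁.suppress-unique
      ; verts⁻       = verts⁻
      ; verts⁺       = verts⁺
      ; arcs⁻        = arcs⁻
      ; kept⁺        = λ (ab , a≢u , a≢v , b≢u , b≢v) →
                         ∈-deleteVertex⁺ G₂ (S₁.∈-suppress⁺ (kept∈G₁ ab a≢u) a≢v b≢v) a≢u b≢u
      ; bypass⁺      = ⊥-elim ∘ u-no-parent
      ; indeg-≡      = indeg-preserved
      ; outdeg-≡     = outdeg-preserved
      ; root∈verts   = verts⁺ (arcsHead uc) c≢u c≢v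
      ; root-indeg   = In.∉⇒deg≡0 G₃ c-no-parent
      ; root-outdeg  = trans (outdeg-preserved c≢u c≢v) (proj₂ (proj₂ c-tree))
      ; root-moved   = inj₂ u≡ρ
      }
      where
      c-no-parent : ∀ {a} → (a , c) ∉ arcs G₃
      c-no-parent ac with arcs⁻ ac
      ... | inj₁ (ac′ , a≢u , _) = a≢u (parent-c ac′)
      ... | inj₂ (inj₁ e) = c≢w (cong proj₂ e)
      ... | inj₂ (inj₂ (au , _)) = u-no-parent au

lemma6 : (X : List ℕ) (G : Graph) (ρ u v : ℕ) →
    IsTreeChildNetwork X G ρ → ¬ HasThreeCycle G →
    IsReticulationArc G (u , v) →
    (∀ u′ v′ d d′ → IsReticulationArc G (u′ , v′) →
      IsDist G ρ u d → IsDist G ρ u′ d′ → d ≤ d′) →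
    Σ ℕ (λ ρ′ → IsTreeChildNetwork X (delRetArc G ρ (u , v)) ρ′)
      × ¬ HasThreeCycle (delRetArc G ρ (u , v))
lemma6 X G ρ u v (inj₁ (_ , _ , no-arcs) , _) _ (uv , _) _ =
  contradiction (subst ((u , v) ∈_) no-arcs uv) λ ()
lemma6 X G ρ u v (inj₂ N , tc) no3 uv-ret closest with u ≟ ρ
... | yes u≡ρ = Properties.treeChild∧no3Cycle (Root.deletion u≡ρ)
  where open ArcDeletion N tc no3 uv-ret closest
... | no u≢ρ = Properties.treeChild∧no3Cycle (NonRoot.deletion u≢ρ)
  where open ArcDeletion N tc no3 uv-ret closest
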